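{- Suppose $(\mathsf P,\mathsf{Opens})$ is a semitopology and $p\in\mathsf P$. Then: \begin{enumerate} \item If $p$ is weakly regular then $\overline{K(p)}=p_{\between}$. In symbols: $ p\in K(p) $ implies $\overline{K(p)}=p_{\between}. $ \item As an immediate corollary, if $p$ is regular then $\overline{K(p)}=p_{\between}$. \end{enumerate}
   Context: A semitopology is a pair $(\mathsf P,\mathsf{Opens})$ with $\mathsf{Opens}\subseteq\mathcal P(\mathsf P)$ containing $\varnothing$ and $\mathsf P$ and closed under arbitrary unions. Points $p,p'$ are intertwined when every open neighbourhood of $p$ intersects every open neighbourhood of $p'$; $p_{\between}$ denotes the set of points intertwined with $p$. $\mathrm{interior}(X)$ is the union of open sets contained in $X$, and $\overline X$ is the closure of $X$ (points every open neighbourhood of which intersects $X$). A set $T$ is topen when it is nonempty, open and transitive (for all open $O,O'$, if $O\cap T\neq\varnothing$ and $T\cap O'\neq\varnothing$ then $O\cap O'\neq\varnothing$). The community of $p$ is $K(p)=\mathrm{interior}(p_{\between})$; $p$ is weakly regular when $p\in K(p)$, and regular when $p\in K(p)$ and $K(p)$ is topen. -}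

module Defs where

open import Level using (Level; suc)
open import Data.Product using (Σ; ∃; _×_; _,_)
open import Relation.Unary using (Pred; _∈_; _⊆_; _≐_; ∅; U)

-- A semitopology: a carrier P together with a family of open sets
-- (indexed by Idx; the set of opens is the image of Op), containing ∅ and P
-- and closed under arbitrary unions (families indexed by any J : Set a).
record Semitopology (a : Level) : Set (suc a) where
  field
    Carrier : Set a
    Idx     : Set a
    Op      : Idx → Pred Carrier a
    open-∅  : ∃ λ i → Op i ≐ ∅
    open-U  : ∃ λ i → Op i ≐ U
    open-⋃  : (J : Set a) (f : J → Idx) →
              ∃ λ i → Op i ≐ (λ x → ∃ λ j → x ∈ Op (f j))

module _ {a : Level} (S : Semitopology a) where
  open Semitopology S

  IsOpen : Pred Carrier a → Set a
  IsOpen X = ∃ λ i → Op i ≐ X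

  interior : Pred Carrier a → Pred Carrier a
  interior X x = ∃ λ i → (Op i ⊆ X) × x ∈ Op i

  closure : Pred Carrier a → Pred Carrier a
  closure X x = ∀ i → x ∈ Op i → ∃ λ y → y ∈ Op i × y ∈ X

  Intertwined : Carrier → Carrier → Set a
  Intertwined p q = ∀ i j → p ∈ Op i → q ∈ Op j → ∃ λ x → x ∈ Op i × x ∈ Op j

  intertwinedSet : Carrier → Pred Carrier a
  intertwinedSet p q = Intertwined p q

  Transitive : Pred Carrier a → Set a
  Transitive T = ∀ i j → (∃ λ x → x ∈ Op i × x ∈ T) → (∃ λ x → x ∈ T × x ∈ Op j) →
                 ∃ λ x → x ∈ Op i × x ∈ Op j

  Topen : Pred Carrier a → Set a
  Topen T = (∃ λ x → x ∈ T) × IsOpen T × Transitive T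

  K : Carrier → Pred Carrier a
  K p = interior (intertwinedSet p)

  WeaklyRegular : Carrier → Set a
  WeaklyRegular p = p ∈ K p

  Regular : Carrier → Set a
  Regular p = p ∈ K p × Topen (K p)

-- The inclusion closure(K(p)) ⊆ p_≬ holds for every p: a neighbourhood of a
-- point of the closure meets some open subset of p_≬, and the meeting point is
-- intertwined with p. Conversely, if p lies in an open O ⊆ p_≬, any neighbourhood
-- of a point intertwined with p meets O ⊆ K(p).
module Submission where

open import Defs
open import Level using (Level)
open import Data.Product using (_×_; _,_; proj₁)
open import Relation.Unary using (Pred; _∈_; _⊆_; _≐_)

module _ {a : Level} (S : Semitopology a) where
  open Semitopology S

  closure-K⊆intertwinedSet : (p : Carrier) → closure S (K S p) ⊆ intertwinedSet S p
  closure-K⊆intertwinedSet p q∈cl i j p∈i q∈j with q∈cl j q∈j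
  ... | y , y∈j , (_ , O⊆p≬ , y∈O) = O⊆p≬ y∈O i j p∈i y∈j

  intertwinedSet⊆closure-interior : {X : Pred Carrier a} {p : Carrier} →
    p ∈ interior S X → intertwinedSet S p ⊆ closure S (interior S X)
  intertwinedSet⊆closure-interior (k , O⊆X , p∈O) p≬q i q∈i with p≬q k i p∈O q∈i
  ... | x , x∈O , x∈i = x , x∈i , (k , O⊆X , x∈O)

  closure-K≐intertwinedSet : (p : Carrier) → WeaklyRegular S p →
    closure S (K S p) ≐ intertwinedSet S p
  closure-K≐intertwinedSet p p∈Kp =
    closure-K⊆intertwinedSet p , intertwinedSet⊆closure-interior p∈Kp

theorem5p30 : {a : Level} (S : Semitopology a) (p : Semitopology.Carrier S) →
              (WeaklyRegular S p → closure S (K S p) ≐ intertwinedSet S p) ×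
              (Regular S p → closure S (K S p) ≐ intertwinedSet S p)
theorem5p30 S p =
  closure-K≐intertwinedSet S p , λ regular → closure-K≐intertwinedSet S p (proj₁ regular)
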